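{- Every prime tournament which is not isomorphic to $P_n$ for any $n$ has at most one matching ordering.
   Context: A tournament has exactly one directed edge between any two distinct vertices. A homogeneous set of $G$ is $X\subseteq V(G)$ such that each $v\notin X$ either beats all of $X$ or is beaten by all of $X$; $G$ is prime if it has no homogeneous set $X$ with $1<|X|<|V(G)|$. For an ordering $v_1,\dots,v_n$ of $V(G)$, a backedge is an edge $v_j\to v_i$ with $j>i$; a matching ordering is an ordering in which every vertex is an end of at most one backedge. $P_n$ is the tournament on $v_1,\dots,v_n$ with $v_i\to v_j$ if $j-i\ge2$ and $v_{i+1}\to v_i$ for $1\le i\le n-1$. -}

module Defs where

open import Data.Nat using (ℕ; _+_; _≤_; _<_)
open import Data.Fin using (Fin; toℕ)
open import Data.Fin.Subset using (Subset; _∈_; _∉_; ∣_∣)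
open import Data.Fin.Permutation using (Permutation′; _⟨$⟩ʳ_)
open import Data.Product using (_×_; Σ; _,_)
open import Data.Sum using (_⊎_)
open import Relation.Nullary using (¬_)
open import Relation.Binary.PropositionalEquality using (_≡_; _≢_)
open import Function.Bundles using (_⇔_)

record Tournament (n : ℕ) : Set₁ where
  field
    _⇒_      : Fin n → Fin n → Set
    irrefl   : ∀ u → ¬ (u ⇒ u)
    total    : ∀ u v → u ≢ v → (u ⇒ v) ⊎ (v ⇒ u)
    asym     : ∀ u v → u ⇒ v → ¬ (v ⇒ u)

open Tournament public

Homogeneous : ∀ {n} → Tournament n → Subset n → Set
Homogeneous {n} G X =
  ∀ (v : Fin n) → v ∉ X →
    (∀ x → x ∈ X → _⇒_ G v x) ⊎ (∀ x → x ∈ X → _⇒_ G x v)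

Prime : ∀ {n} → Tournament n → Set
Prime {n} G = ∀ (X : Subset n) → Homogeneous G X → ¬ (1 < ∣ X ∣ × ∣ X ∣ < n)

-- The edge relation of P_n on vertices Fin n (0-based: vertex i is v_{i+1}):
-- i → j iff j - i ≥ 2, or i = j + 1.
PEdge : ∀ {n} → Fin n → Fin n → Set
PEdge i j = (toℕ i + 2 ≤ toℕ j) ⊎ (toℕ i ≡ toℕ j + 1)

-- G is isomorphic to P_n (n = |V(G)|, the only P_m it could be isomorphic to).
IsoToP : ∀ {n} → Tournament n → Set
IsoToP {n} G = Σ (Permutation′ n) λ f →
  ∀ u v → (_⇒_ G u v ⇔ PEdge (f ⟨$⟩ʳ u) (f ⟨$⟩ʳ v))

-- An ordering: a bijection σ from positions Fin n to vertices; position i holds v_{i+1}.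
Ordering : ℕ → Set
Ordering n = Permutation′ n

Backedge : ∀ {n} → Tournament n → Ordering n → Fin n → Fin n → Set
Backedge G σ i j = (toℕ i < toℕ j) × _⇒_ G (σ ⟨$⟩ʳ j) (σ ⟨$⟩ʳ i)

-- Matching ordering: every vertex (equivalently, position) is an end of at most
-- one backedge.
IsEnd : ∀ {n} → Fin n → Fin n → Fin n → Set
IsEnd k i j = (k ≡ i) ⊎ (k ≡ j)

Matching : ∀ {n} → Tournament n → Ordering n → Set
Matching G σ = ∀ k i j i' j' →
  Backedge G σ i j → Backedge G σ i' j' →
  IsEnd k i j → IsEnd k i' j' → (i ≡ i') × (j ≡ j')

module Submission where

-- Compare the two matching orderings on the positions 0 … n-1 of σ, writing q a for the
-- position in τ of the vertex at σ-position a.  A pair a < b with q b < q a (an inversion)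
-- is a backedge of exactly one of σ and τ, so a position has at most two inversion partners.
-- Without inversions q is increasing, hence the identity, and σ = τ.  Otherwise primality
-- takes over: an interval of positions closed under σ-backedges is homogeneous, which
-- forces every position to be inverted, every σ-backedge to be an inversion and every cut
-- to be crossed by one.  Inversions then span at most three steps in a rigid local
-- pattern, and swapping each inverted adjacent pair a, a+1 turns σ into an isomorphism
-- with P_n: the σ-backedges become exactly the pairs i+1 → i.

open import Defs
open import Data.Nat
  using (ℕ; zero; suc; pred; _+_; _∸_; _≤_; _<_; z≤n; s≤s; s≤s⁻¹; z<s; s<s; _≤?_; _<?_; _≟_)
open import Data.Nat.Properties
open import Data.Fin using (Fin; toℕ; fromℕ<) renaming (zero to fzero; suc to fsuc)
open import Data.Fin.Properties using (toℕ-fromℕ<; fromℕ<-toℕ; toℕ-injective; toℕ<n)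
open import Data.Fin.Subset using (Subset; _∈_; ∣_∣)
open import Data.Fin.Subset.Properties
  using (∈⊤; x∈⁅y⁆⇒x≡y; p⊂q⇒∣p∣<∣q∣; ∣⁅x⁆∣≡1; ∣⊤∣≡n)
open import Data.Fin.Permutation
  using (Permutation′; _⟨$⟩ʳ_; _⟨$⟩ˡ_; inverseˡ; inverseʳ; permutation)
import Data.Fin.Permutation as Permutation
open import Data.Vec using (tabulate)
open import Data.Vec.Properties using (lookup∘tabulate; []=⇒lookup; lookup⇒[]=)
open import Data.Product using (_×_; Σ; ∃; _,_; proj₁; proj₂)
open import Data.Sum using (_⊎_; inj₁; inj₂)
import Data.Sum as Sum
open import Data.Empty using (⊥; ⊥-elim)
open import Function using (_∘_; id)
open import Function.Bundles using (Injection)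
open import Function.Properties.Inverse using (↔⇒↣)
open import Function.Bundles using (_⇔_; mk⇔; Equivalence)
open import Function.Construct.Composition using (_⇔-∘_)
open import Function.Construct.Symmetry using (⇔-sym)
open import Data.Bool.Properties using (T-≡)
open import Relation.Nullary using (¬_; Dec; yes; no)
open import Relation.Nullary.Decidable using (_×-dec_; _⊎-dec_; map′; isYes; toWitness; fromWitness)
open import Relation.Unary using (Decidable)
open import Relation.Binary using (tri<; tri≈; tri>)
open import Relation.Binary.PropositionalEquality using (_≡_; _≢_; refl; sym; trans; cong; subst; subst₂)
open Relation.Binary.PropositionalEquality.≡-Reasoning

record MaximalRun (P : ℕ → Set) (n a : ℕ) : Set where
  field
    lo hi     : ℕ
    lo≤a      : lo ≤ a
    a<hi      : a < hi
    hi≤n      : hi ≤ n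
    inside    : ∀ k → lo ≤ k → k < hi → P k
    left-end  : lo ≡ 0 ⊎ Σ ℕ λ l → lo ≡ suc l × ¬ P l
    right-end : hi ≡ n ⊎ hi < n × ¬ P hi

module _ {P : ℕ → Set} (P? : Decidable P) where

  run-start : ∀ a → P a → Σ ℕ λ lo → lo ≤ a × (∀ k → lo ≤ k → k ≤ a → P k) ×
                                       (lo ≡ 0 ⊎ Σ ℕ λ l → lo ≡ suc l × ¬ P l)
  run-start zero p0 = 0 , z≤n , (λ { zero _ _ → p0 }) , inj₁ refl
  run-start (suc a) p with P? a
  ... | no ¬pa =
    suc a , ≤-refl , (λ k 1+a≤k k≤1+a → subst P (≤-antisym 1+a≤k k≤1+a) p) , inj₂ (a , refl , ¬pa)
  ... | yes pa with run-start a pa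
  ...   | lo , lo≤a , inside , end = lo , m≤n⇒m≤1+n lo≤a , extend , end
    where
    extend : ∀ k → lo ≤ k → k ≤ suc a → P k
    extend k lo≤k k≤1+a with m≤n⇒m<n∨m≡n k≤1+a
    ... | inj₁ k<1+a = inside k lo≤k (s≤s⁻¹ k<1+a)
    ... | inj₂ refl  = p

  run-end : ∀ {a} N → a < N → P a →
            Σ ℕ λ hi → a < hi × hi ≤ N × (∀ k → a ≤ k → k < hi → P k) ×
                       (hi ≡ N ⊎ hi < N × ¬ P hi)
  run-end {a} (suc N) a<1+N pa with m≤n⇒m<n∨m≡n (s≤s⁻¹ a<1+N)
  ... | inj₂ refl =
    suc a , ≤-refl , ≤-refl , (λ k a≤k k<1+a → subst P (≤-antisym a≤k (s≤s⁻¹ k<1+a)) pa) , inj₁ refl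
  ... | inj₁ a<N with run-end N a<N pa
  ...   | hi , a<hi , hi≤N , inside , inj₂ (hi<N , ¬phi) =
          hi , a<hi , m≤n⇒m≤1+n hi≤N , inside , inj₂ (m<n⇒m<1+n hi<N , ¬phi)
  ...   | hi , a<hi , hi≤N , inside , inj₁ refl with P? hi
  ...     | no ¬phi = hi , a<hi , n≤1+n hi , inside , inj₂ (n<1+n hi , ¬phi)
  ...     | yes phi = suc hi , m<n⇒m<1+n a<hi , ≤-refl , extend , inj₁ refl
    where
    extend : ∀ k → a ≤ k → k < suc hi → P k
    extend k a≤k k<1+hi with m≤n⇒m<n∨m≡n (s≤s⁻¹ k<1+hi)
    ... | inj₁ k<hi = inside k a≤k k<hi
    ... | inj₂ refl = phi

  maximal-run : ∀ {n a} → a < n → P a → MaximalRun P n a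
  maximal-run {n} {a} a<n pa with run-start a pa | run-end n a<n pa
  ... | lo , lo≤a , left , left-end | hi , a<hi , hi≤n , right , right-end = record
    { lo = lo ; hi = hi ; lo≤a = lo≤a ; a<hi = a<hi ; hi≤n = hi≤n
    ; inside = inside ; left-end = left-end ; right-end = right-end }
    where
    inside : ∀ k → lo ≤ k → k < hi → P k
    inside k lo≤k k<hi with k ≤? a
    ... | yes k≤a = left k lo≤k k≤a
    ... | no  k≰a = right k (<⇒≤ (≰⇒> k≰a)) k<hi

module _ {n : ℕ} (f : ℕ → ℕ) (f-mono : ∀ {a b} → a < b → b < n → f a < f b)
         (f-< : ∀ {a} → a < n → f a < n) where

  m≤f[m] : ∀ {a} → a < n → a ≤ f a
  m≤f[m] {zero}  _     = z≤n
  m≤f[m] {suc a} 1+a<n = ≤-<-trans (m≤f[m] (<-trans (n<1+n a) 1+a<n)) (f-mono (n<1+n a) 1+a<n)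

  f[m]+d<n : ∀ d {a} → a + d < n → f a + d < n
  f[m]+d<n zero {a} a+0<n =
    subst (_< n) (sym (+-identityʳ (f a))) (f-< (subst (_< n) (+-identityʳ a) a+0<n))
  f[m]+d<n (suc d) {a} a+1+d<n = ≤-<-trans step (f[m]+d<n d 1+a+d<n)
    where
    1+a+d<n : suc a + d < n
    1+a+d<n = subst (_< n) (+-suc a d) a+1+d<n
    step : f a + suc d ≤ f (suc a) + d
    step = subst (_≤ f (suc a) + d) (sym (+-suc (f a) d))
                 (+-monoˡ-≤ d (f-mono (n<1+n a) (≤-<-trans (m≤m+n (suc a) d) 1+a+d<n)))

  f[m]≡m : ∀ {a} → a < n → f a ≡ a
  f[m]≡m {a} a<n = ≤-antisym (s≤s⁻¹ (+-cancelʳ-≤ d (suc (f a)) (suc a) fa+d<1+a+d)) (m≤f[m] a<n)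
    where
    d = n ∸ suc a
    1+a+d≡n : suc a + d ≡ n
    1+a+d≡n = m+[n∸m]≡n a<n
    fa+d<1+a+d : suc (f a) + d ≤ suc a + d
    fa+d<1+a+d = subst (suc (f a) + d ≤_) (sym 1+a+d≡n)
                       (f[m]+d<n d (subst (_≤ n) (sym 1+a+d≡n) ≤-refl))

-- {x, y} is a backedge of the ordering of 0 … n-1 by the rank r.
Back : ℕ → (ℕ → ℕ → Set) → (ℕ → ℕ) → ℕ → ℕ → Set
Back n _beats_ r x y = x < n × y < n × ((r x < r y × y beats x) ⊎ (r y < r x × x beats y))

Back-sym : ∀ {n E r x y} → Back n E r x y → Back n E r y x
Back-sym (x<n , y<n , e) = y<n , x<n , Sum.swap e

InInterval : ℕ → ℕ → ℕ → Set
InInterval lo hi x = lo ≤ x × x < hi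

InInterval-suc : ∀ {lo hi x} → InInterval lo (suc hi) x → x ≡ hi ⊎ InInterval lo hi x
InInterval-suc (lo≤x , x<1+hi) = Sum.swap (Sum.map (lo≤x ,_) id (m≤n⇒m<n∨m≡n (s≤s⁻¹ x<1+hi)))

k+lo∈ : ∀ {k m} lo → k < m → InInterval lo (m + lo) (k + lo)
k+lo∈ {k} lo k<m = m≤n+m lo k , +-monoˡ-< lo k<m

BackPartner : ∀ {n} → Tournament n → Ordering n → Fin n → Fin n → Set
BackPartner G ρ k j = Backedge G ρ k j ⊎ Backedge G ρ j k

Matching⇒partner-unique : ∀ {n} {G : Tournament n} {ρ : Ordering n} → Matching G ρ →
                          ∀ {k j j′} → BackPartner G ρ k j → BackPartner G ρ k j′ → j ≡ j′
Matching⇒partner-unique matching (inj₁ kj) (inj₁ kj′) =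
  proj₂ (matching _ _ _ _ _ kj kj′ (inj₁ refl) (inj₁ refl))
Matching⇒partner-unique matching (inj₁ kj) (inj₂ j′k) =
  let (k≡j′ , j≡k) = matching _ _ _ _ _ kj j′k (inj₁ refl) (inj₂ refl) in trans j≡k k≡j′
Matching⇒partner-unique matching (inj₂ jk) (inj₁ kj′) =
  let (j≡k , k≡j′) = matching _ _ _ _ _ jk kj′ (inj₂ refl) (inj₁ refl) in trans j≡k k≡j′
Matching⇒partner-unique matching (inj₂ jk) (inj₂ j′k) =
  proj₁ (matching _ _ _ _ _ jk j′k (inj₂ refl) (inj₂ refl))

PEdgeℕ : ℕ → ℕ → Set
PEdgeℕ x y = 2 + x ≤ y ⊎ x ≡ suc y

PEdgeℕ-irrefl : ∀ {x} → ¬ PEdgeℕ x x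
PEdgeℕ-irrefl (inj₁ 2+x≤x)  = <-irrefl refl (<-trans (n<1+n _) 2+x≤x)
PEdgeℕ-irrefl (inj₂ x≡1+x) = <⇒≢ (n<1+n _) x≡1+x

PEdgeℕ-¬suc : ∀ {x} → ¬ PEdgeℕ x (suc x)
PEdgeℕ-¬suc (inj₁ 2+x≤1+x) = <-irrefl refl 2+x≤1+x
PEdgeℕ-¬suc (inj₂ x≡2+x)   = <⇒≢ (m<n+m _ {2} z<s) x≡2+x

NoHomogeneousSet : ℕ → (ℕ → ℕ → Set) → Set₁
NoHomogeneousSet n _beats_ = (P : ℕ → Set) → Decidable P → (∀ x → P x → x < n) →
  ∀ {x y w} → P x → P y → x ≢ y → w < n → ¬ P w →
  ¬ (∀ w → w < n → ¬ P w → (∀ x → P x → w beats x) ⊎ (∀ x → P x → x beats w))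

module TwoMatchingOrders
  (n : ℕ) (_beats_ : ℕ → ℕ → Set) (q : ℕ → ℕ)
  (beats-total : ∀ {a b} → a < n → b < n → a ≢ b → a beats b ⊎ b beats a)
  (beats-asym : ∀ {a b} → a beats b → ¬ b beats a)
  (q-injective : ∀ {a b} → a < n → b < n → q a ≡ q b → a ≡ b)
  (back₁-unique : ∀ {x y z} → Back n _beats_ id x y → Back n _beats_ id x z → y ≡ z)
  (back₂-unique : ∀ {x y z} → Back n _beats_ q x y → Back n _beats_ q x z → y ≡ z)
  where

  Back₁ Back₂ : ℕ → ℕ → Set
  Back₁ = Back n _beats_ id
  Back₂ = Back n _beats_ q

  Back₁-sym : ∀ {x y} → Back₁ x y → Back₁ y x
  Back₁-sym = Back-sym {E = _beats_} {r = id}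

  Back₂-sym : ∀ {x y} → Back₂ x y → Back₂ y x
  Back₂-sym = Back-sym {E = _beats_} {r = q}

  Back₁-beats : ∀ {a b} → a < b → Back₁ a b → b beats a
  Back₁-beats a<b (_ , _ , inj₁ (_ , b→a)) = b→a
  Back₁-beats a<b (_ , _ , inj₂ (b<a , _)) = ⊥-elim (<-asym a<b b<a)

  Inv : ℕ → ℕ → Set
  Inv a b = a < b × b < n × q b < q a

  Inv? : ∀ a b → Dec (Inv a b)
  Inv? a b = a <? b ×-dec b <? n ×-dec q b <? q a

  Inverted : ℕ → ℕ → Set
  Inverted x y = Inv x y ⊎ Inv y x

  Inverted? : ∀ x y → Dec (Inverted x y)
  Inverted? x y = Inv? x y ⊎-dec Inv? y x

  Inv-<n : ∀ {a b} → Inv a b → a < n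
  Inv-<n (a<b , b<n , _) = <-trans a<b b<n

  Inverted-<n : ∀ {x y} → Inverted x y → x < n × y < n
  Inverted-<n (inj₁ xy@(_ , y<n , _)) = Inv-<n xy , y<n
  Inverted-<n (inj₂ yx@(_ , x<n , _)) = x<n , Inv-<n yx

  Inv-split : ∀ {a b c} → a < b → b < c → Inv a c → Inv a b ⊎ Inv b c
  Inv-split {a} {b} {c} a<b b<c ac@(a<c , c<n , qc<qa) with <-cmp (q a) (q b)
  ... | tri< qa<qb _ _ = inj₂ (b<c , c<n , <-trans qc<qa qa<qb)
  ... | tri≈ _ qa≡qb _ = ⊥-elim (<⇒≢ a<b (q-injective (Inv-<n ac) (<-trans b<c c<n) qa≡qb))
  ... | tri> _ _ qb<qa = inj₁ (a<b , <-trans b<c c<n , qb<qa)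

  Inv-trans : ∀ {a b c} → Inv a b → Inv b c → Inv a c
  Inv-trans (a<b , _ , qb<qa) (b<c , c<n , qc<qb) = <-trans a<b b<c , c<n , <-trans qc<qb qb<qa

  Inv⇒Back : ∀ {a b} → Inv a b → Back₁ a b ⊎ Back₂ a b
  Inv⇒Back ab@(a<b , b<n , qb<qa) with beats-total (Inv-<n ab) b<n (<⇒≢ a<b)
  ... | inj₁ a→b = inj₂ (Inv-<n ab , b<n , inj₂ (qb<qa , a→b))
  ... | inj₂ b→a = inj₁ (Inv-<n ab , b<n , inj₁ (a<b , b→a))

  Inverted⇒Back : ∀ {x y} → Inverted x y → Back₁ x y ⊎ Back₂ x y
  Inverted⇒Back (inj₁ xy) = Inv⇒Back xy
  Inverted⇒Back (inj₂ yx) = Sum.map Back₁-sym Back₂-sym (Inv⇒Back yx)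

  Inv-¬Back₁×Back₂ : ∀ {a b} → Inv a b → Back₁ a b → ¬ Back₂ a b
  Inv-¬Back₁×Back₂ (a<b , _ , _) (_ , _ , inj₂ (b<a , _)) _ = <-asym a<b b<a
  Inv-¬Back₁×Back₂ (_ , _ , qb<qa) _ (_ , _ , inj₁ (qa<qb , _)) = <-asym qa<qb qb<qa
  Inv-¬Back₁×Back₂ _ (_ , _ , inj₁ (_ , b→a)) (_ , _ , inj₂ (_ , a→b)) = beats-asym a→b b→a

  Back₁-uninverted⇒Back₂ : ∀ {x y} → ¬ Inverted x y → Back₁ x y → Back₂ x y
  Back₁-uninverted⇒Back₂ {x} {y} ¬xy (x<n , y<n , e) with <-cmp (q x) (q y) | e
  ... | tri< qx<qy _ _ | inj₁ (_ , y→x)   = x<n , y<n , inj₁ (qx<qy , y→x)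
  ... | tri< qx<qy _ _ | inj₂ (y<x , _)   = ⊥-elim (¬xy (inj₂ (y<x , x<n , qx<qy)))
  ... | tri≈ _ qx≡qy _ | _               =
    ⊥-elim (Sum.[ <⇒≢ , >⇒≢ ]′ (Sum.map proj₁ proj₁ e) (q-injective x<n y<n qx≡qy))
  ... | tri> _ _ qy<qx | inj₁ (x<y , _)   = ⊥-elim (¬xy (inj₁ (x<y , y<n , qy<qx)))
  ... | tri> _ _ qy<qx | inj₂ (_ , x→y)   = x<n , y<n , inj₂ (qy<qx , x→y)

  Inverted-partners : ∀ {x y z} → Inverted x y → Inverted x z → y ≢ z →
                      Back₁ x y × Back₂ x z ⊎ Back₂ x y × Back₁ x z
  Inverted-partners xy xz y≢z with Inverted⇒Back xy | Inverted⇒Back xz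
  ... | inj₁ b₁ | inj₁ b₁′ = ⊥-elim (y≢z (back₁-unique b₁ b₁′))
  ... | inj₁ b₁ | inj₂ b₂  = inj₁ (b₁ , b₂)
  ... | inj₂ b₂ | inj₁ b₁  = inj₂ (b₂ , b₁)
  ... | inj₂ b₂ | inj₂ b₂′ = ⊥-elim (y≢z (back₂-unique b₂ b₂′))

  Inverted-degree≤2 : ∀ {x a b c} → Inverted x a → Inverted x b → Inverted x c →
                      a ≢ b → a ≢ c → b ≢ c → ⊥
  Inverted-degree≤2 xa xb xc a≢b a≢c b≢c with Inverted-partners xa xb a≢b | Inverted⇒Back xc
  ... | inj₁ (b₁ , _) | inj₁ b₁′ = a≢c (back₁-unique b₁ b₁′)
  ... | inj₁ (_ , b₂) | inj₂ b₂′ = b≢c (back₂-unique b₂ b₂′)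
  ... | inj₂ (b₂ , _) | inj₂ b₂′ = a≢c (back₂-unique b₂ b₂′)
  ... | inj₂ (_ , b₁) | inj₁ b₁′ = b≢c (back₁-unique b₁ b₁′)

  Inverted-partner-Back₁ : ∀ {x y z} → Inverted x y → Back₂ x z → y ≢ z → Back₁ x y
  Inverted-partner-Back₁ xy b₂ y≢z with Inverted⇒Back xy
  ... | inj₁ b₁  = b₁
  ... | inj₂ b₂′ = ⊥-elim (y≢z (back₂-unique b₂′ b₂))

  ¬Inv-chain : ∀ {a b c} → Inv a b → ¬ Inv b c
  ¬Inv-chain {a} {b} {c} ab bc
    with Inverted-partners (inj₂ ab) (inj₁ bc) (<⇒≢ (<-trans a<b b<c))
       | Inverted-partners (inj₁ ab) (inj₁ (Inv-trans ab bc)) (<⇒≢ b<c)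
    where a<b = proj₁ ab
          b<c = proj₁ bc
  ... | inj₁ (ba₁ , _) | inj₂ (ab₂ , _) = Inv-¬Back₁×Back₂ ab (Back₁-sym ba₁) ab₂
  ... | inj₂ (ba₂ , _) | inj₁ (ab₁ , _) = Inv-¬Back₁×Back₂ ab ab₁ (Back₂-sym ba₂)
  ... | inj₁ (_ , bc₂) | inj₁ (_ , ac₂) =
    <⇒≢ (proj₁ ab) (back₂-unique (Back₂-sym ac₂) (Back₂-sym bc₂))
  ... | inj₂ (_ , bc₁) | inj₂ (_ , ac₁) =
    <⇒≢ (proj₁ ab) (back₁-unique (Back₁-sym ac₁) (Back₁-sym bc₁))

  Inv-span : ∀ {a b} → Inv a b → b ≤ 3 + a
  Inv-span {a} {b} ab with b ≤? 3 + a
  ... | yes b≤3+a = b≤3+a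
  ... | no  b≰3+a = pigeonhole (Inv-split a<k+a 1+a<b ab) (Inv-split a<k+a 2+a<b ab)
                               (Inv-split a<k+a 3+a<b ab)
    where
    a<k+a : ∀ {k} → a < suc k + a
    a<k+a = m<n+m a z<s
    3+a<b : 3 + a < b
    3+a<b = ≰⇒> b≰3+a
    2+a<b : 2 + a < b
    2+a<b = <-trans (n<1+n _) 3+a<b
    1+a<b : 1 + a < b
    1+a<b = <-trans (n<1+n _) 2+a<b
    two-left : ∀ {i j} → i < b → j < b → i ≢ j → Inv a i → Inv a j → ⊥
    two-left i<b j<b i≢j ai aj =
      Inverted-degree≤2 (inj₁ ab) (inj₁ ai) (inj₁ aj) (>⇒≢ i<b) (>⇒≢ j<b) i≢j
    two-right : ∀ {i j} → a < i → a < j → i ≢ j → Inv i b → Inv j b → ⊥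
    two-right a<i a<j i≢j ib jb =
      Inverted-degree≤2 (inj₂ ab) (inj₂ ib) (inj₂ jb) (<⇒≢ a<i) (<⇒≢ a<j) i≢j
    1+a≢2+a : 1 + a ≢ 2 + a
    1+a≢2+a = <⇒≢ (n<1+n _)
    1+a≢3+a : 1 + a ≢ 3 + a
    1+a≢3+a = <⇒≢ (m<n+m (1 + a) {2} z<s)
    2+a≢3+a : 2 + a ≢ 3 + a
    2+a≢3+a = <⇒≢ (n<1+n _)
    pigeonhole : Inv a (1 + a) ⊎ Inv (1 + a) b → Inv a (2 + a) ⊎ Inv (2 + a) b →
                 Inv a (3 + a) ⊎ Inv (3 + a) b → b ≤ 3 + a
    pigeonhole (inj₁ a1) (inj₁ a2) _         = ⊥-elim (two-left 1+a<b 2+a<b 1+a≢2+a a1 a2)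
    pigeonhole (inj₁ a1) (inj₂ _)  (inj₁ a3) = ⊥-elim (two-left 1+a<b 3+a<b 1+a≢3+a a1 a3)
    pigeonhole (inj₁ _)  (inj₂ 2b) (inj₂ 3b) = ⊥-elim (two-right a<k+a a<k+a 2+a≢3+a 2b 3b)
    pigeonhole (inj₂ _)  (inj₁ a2) (inj₁ a3) = ⊥-elim (two-left 2+a<b 3+a<b 2+a≢3+a a2 a3)
    pigeonhole (inj₂ 1b) (inj₁ _)  (inj₂ 3b) = ⊥-elim (two-right a<k+a a<k+a 1+a≢3+a 1b 3b)
    pigeonhole (inj₂ 1b) (inj₂ 2b) _         = ⊥-elim (two-right a<k+a a<k+a 1+a≢2+a 1b 2b)

  Inv-reach : ∀ {a b} → Inv a b → b ≡ 1 + a ⊎ b ≡ 2 + a ⊎ b ≡ 3 + a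
  Inv-reach {a} ab with InInterval-suc {1 + a} {3 + a} (proj₁ ab , s≤s (Inv-span ab))
  ... | inj₁ b≡3+a = inj₂ (inj₂ b≡3+a)
  ... | inj₂ b∈ with InInterval-suc b∈
  ...   | inj₁ b≡2+a = inj₂ (inj₁ b≡2+a)
  ...   | inj₂ b∈′ with InInterval-suc b∈′
  ...     | inj₁ b≡1+a = inj₁ b≡1+a
  ...     | inj₂ (1+a≤b , b<1+a) = ⊥-elim (<⇒≱ b<1+a 1+a≤b)

  Back₁-Closed : ℕ → ℕ → Set
  Back₁-Closed lo hi = ∀ {x y} → Back₁ x y → InInterval lo hi x → InInterval lo hi y

  Back₁-Closed⇒homogeneous : ∀ {lo hi} → hi ≤ n → Back₁-Closed lo hi →
    ∀ w → w < n → ¬ InInterval lo hi w →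
    (∀ x → InInterval lo hi x → w beats x) ⊎ (∀ x → InInterval lo hi x → x beats w)
  Back₁-Closed⇒homogeneous {lo} {hi} hi≤n closed w w<n w∉ with lo ≤? w
  ... | no lo≰w = inj₁ λ x x∈ → beats-rightwards x x∈ (<-≤-trans (≰⇒> lo≰w) (proj₁ x∈))
    where
    beats-rightwards : ∀ x → InInterval lo hi x → w < x → w beats x
    beats-rightwards x x∈@(_ , x<hi) w<x with beats-total w<n (<-≤-trans x<hi hi≤n) (<⇒≢ w<x)
    ... | inj₁ w→x = w→x
    ... | inj₂ x→w =
      ⊥-elim (lo≰w (proj₁ (closed (<-≤-trans x<hi hi≤n , w<n , inj₂ (w<x , x→w)) x∈)))
  ... | yes lo≤w = inj₂ beats-leftwards
    where
    hi≤w : hi ≤ w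
    hi≤w = ≮⇒≥ (λ w<hi → w∉ (lo≤w , w<hi))
    beats-leftwards : ∀ x → InInterval lo hi x → x beats w
    beats-leftwards x x∈@(_ , x<hi) = by-totality (beats-total x<n w<n (<⇒≢ x<w))
      where
      x<n = <-≤-trans x<hi hi≤n
      x<w = <-≤-trans x<hi hi≤w
      by-totality : x beats w ⊎ w beats x → x beats w
      by-totality (inj₁ x→w) = x→w
      by-totality (inj₂ w→x) = ⊥-elim (<⇒≱ (proj₂ (closed (x<n , w<n , inj₁ (x<w , w→x)) x∈)) hi≤w)

  IsInverted : ℕ → Set
  IsInverted x = ∃ (Inverted x)

  IsInverted? : Decidable IsInverted
  IsInverted? x = map′ (λ (y , _ , xy) → y , xy) (λ (y , xy) → y , proj₂ (Inverted-<n xy) , xy)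
                       (anyUpTo? (Inverted? x) n)

  -- x's inversion partner already uses one of its two backedges, and a
  -- non-inverted σ-backedge would be a τ-backedge as well.
  Back₁-at-inverted : ∀ {x y} → IsInverted x → Back₁ x y → Inverted x y
  Back₁-at-inverted {x} {y} (z , xz) xy with Inverted? x y
  ... | yes xy-inverted = xy-inverted
  ... | no ¬xy-inverted with Inverted⇒Back xz
  ...   | inj₁ xz₁ = subst (Inverted x) (back₁-unique xz₁ xy) xz
  ...   | inj₂ xz₂ =
    subst (Inverted x) (back₂-unique xz₂ (Back₁-uninverted⇒Back₂ ¬xy-inverted xy)) xz

  Inverted-stays-right : ∀ {l x y} → ¬ IsInverted l → l < x → Inverted x y → l < y
  Inverted-stays-right {l} {x} {y} ¬l l<x xy with <-cmp l y
  ... | tri< l<y _ _ = l<y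
  ... | tri≈ _ refl _ = ⊥-elim (¬l (x , Sum.swap xy))
  ... | tri> _ _ y<l with xy
  ...   | inj₁ (x<y , _) = ⊥-elim (<-asym x<y (<-trans y<l l<x))
  ...   | inj₂ yx =
    ⊥-elim (¬l (Sum.[ (λ yl → y , inj₂ yl) , (λ lx → x , inj₁ lx) ]′ (Inv-split y<l l<x yx)))

  Inverted-stays-left : ∀ {u x y} → ¬ IsInverted u → x < u → Inverted x y → y < u
  Inverted-stays-left {u} {x} {y} ¬u x<u xy with <-cmp y u
  ... | tri< y<u _ _ = y<u
  ... | tri≈ _ refl _ = ⊥-elim (¬u (x , Sum.swap xy))
  ... | tri> _ _ u<y with xy
  ...   | inj₂ (y<x , _) = ⊥-elim (<-asym y<x (<-trans x<u u<y))
  ...   | inj₁ xy′ =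
    ⊥-elim (¬u (Sum.[ (λ xu → x , inj₂ xu) , (λ uy → y , inj₁ uy) ]′ (Inv-split x<u u<y xy′)))

  Back₁-Closed-by-partners : ∀ {lo hi} →
    (∀ {x} → InInterval lo hi x → ∃ λ y → Back₁ x y × InInterval lo hi y) → Back₁-Closed lo hi
  Back₁-Closed-by-partners {lo} {hi} partner xy x∈ with partner x∈
  ... | _ , xy′ , y′∈ = subst (InInterval lo hi) (back₁-unique xy′ xy) y′∈

  module WithInversion (3≤n : 3 ≤ n) (no-homogeneous : NoHomogeneousSet n _beats_)
                       {a₀ b₀ : ℕ} (inv₀ : Inv a₀ b₀) where

    ¬Back₁-closed : ∀ {lo hi} → suc lo < hi → hi ≤ n → 0 < lo ⊎ hi < n → ¬ Back₁-Closed lo hi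
    ¬Back₁-closed {lo} {hi} 1+lo<hi hi≤n proper closed =
      let (w , w<n , w∉) = outside proper in
      no-homogeneous (InInterval lo hi) (λ x → lo ≤? x ×-dec x <? hi)
        (λ x (_ , x<hi) → <-≤-trans x<hi hi≤n)
        (≤-refl , <-trans (n<1+n lo) 1+lo<hi) (n≤1+n lo , 1+lo<hi) (<⇒≢ (n<1+n lo)) w<n w∉
        (Back₁-Closed⇒homogeneous hi≤n closed)
      where
      outside : 0 < lo ⊎ hi < n → Σ ℕ λ w → w < n × ¬ InInterval lo hi w
      outside (inj₁ 0<lo) = 0 , <-≤-trans (<-trans 0<lo (<-trans (n<1+n lo) 1+lo<hi)) hi≤n ,
                            λ (lo≤0 , _) → <⇒≱ 0<lo lo≤0
      outside (inj₂ hi<n) = hi , hi<n , λ (_ , hi<hi) → <-irrefl refl hi<hi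

    -- The maximal run of inverted positions around a₀ is closed under inversions,
    -- hence (Back₁-at-inverted) under σ-backedges.
    all-inverted : ∀ {x} → x < n → IsInverted x
    all-inverted {x} x<n = run-is-everything left-end right-end
      where
      open MaximalRun (maximal-run IsInverted? (Inv-<n inv₀) (b₀ , inj₁ inv₀))
      run-closed : ∀ {y z} → InInterval lo hi y → Inverted y z → InInterval lo hi z
      run-closed {y} {z} (lo≤y , y<hi) yz = left-bound left-end , right-bound right-end
        where
        left-bound : lo ≡ 0 ⊎ Σ ℕ (λ l → lo ≡ suc l × ¬ IsInverted l) → lo ≤ z
        left-bound (inj₁ lo≡0) = subst (_≤ z) (sym lo≡0) z≤n
        left-bound (inj₂ (l , lo≡1+l , ¬l)) =
          subst (_≤ z) (sym lo≡1+l) (Inverted-stays-right ¬l (subst (_≤ y) lo≡1+l lo≤y) yz)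
        right-bound : hi ≡ n ⊎ hi < n × ¬ IsInverted hi → z < hi
        right-bound (inj₁ hi≡n)      = subst (z <_) (sym hi≡n) (proj₂ (Inverted-<n yz))
        right-bound (inj₂ (_ , ¬hi)) = Inverted-stays-left ¬hi y<hi yz
      ¬proper-run : ¬ (0 < lo ⊎ hi < n)
      ¬proper-run proper = ¬Back₁-closed 1+lo<hi hi≤n proper
        (λ yz y∈ → run-closed y∈ (Back₁-at-inverted (inside _ (proj₁ y∈) (proj₂ y∈)) yz))
        where
        1+lo<hi : suc lo < hi
        1+lo<hi = ≤-<-trans (≤-trans (s≤s lo≤a) (proj₁ inv₀))
                            (proj₂ (run-closed (lo≤a , a<hi) (inj₁ inv₀)))
      run-is-everything : lo ≡ 0 ⊎ Σ ℕ (λ l → lo ≡ suc l × ¬ IsInverted l) →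
                          hi ≡ n ⊎ hi < n × ¬ IsInverted hi → IsInverted x
      run-is-everything (inj₁ lo≡0) (inj₁ hi≡n) =
        inside x (subst (_≤ x) (sym lo≡0) z≤n) (subst (x <_) (sym hi≡n) x<n)
      run-is-everything (inj₂ (l , lo≡1+l , _)) _ =
        ⊥-elim (¬proper-run (inj₁ (subst (0 <_) (sym lo≡1+l) z<s)))
      run-is-everything (inj₁ _) (inj₂ (hi<n , _)) = ⊥-elim (¬proper-run (inj₂ hi<n))

    Back₁⇒Inverted : ∀ {x y} → Back₁ x y → Inverted x y
    Back₁⇒Inverted xy = Back₁-at-inverted (all-inverted (proj₁ xy)) xy

    -- σ-backedges are inversions, so an uncrossed cut c closes [0, c) (or [1, n) when
    -- c = 1) under σ-backedges.
    ¬uncrossed-cut : ∀ {c} → 0 < c → c < n → ¬ (∀ {u v} → u < c → c ≤ v → ¬ Inv u v)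
    ¬uncrossed-cut {suc zero} _ _ uncrossed = ¬Back₁-closed 3≤n ≤-refl (inj₁ z<s) closed
      where
      closed : Back₁-Closed 1 n
      closed {x} {zero} x0 (1≤x , _) with Back₁⇒Inverted x0
      ... | inj₂ 0x = ⊥-elim (uncrossed z<s 1≤x 0x)
      closed {x} {suc y} x1+y _ = s≤s z≤n , proj₁ (proj₂ x1+y)
    ¬uncrossed-cut {suc (suc c)} _ c<n uncrossed =
      ¬Back₁-closed (s≤s (s≤s z≤n)) (<⇒≤ c<n) (inj₂ c<n) closed
      where
      closed : Back₁-Closed 0 (suc (suc c))
      closed {x} {y} xy (_ , x<c) with y <? suc (suc c)
      ... | yes y<c = z≤n , y<c
      ... | no  y≮c with Back₁⇒Inverted xy
      ...   | inj₁ xy′          = ⊥-elim (uncrossed x<c (≮⇒≥ y≮c) xy′)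
      ...   | inj₂ (y<x , _)    = ⊥-elim (y≮c (<-trans y<x x<c))

    Inv-across : ∀ {c} → 0 < c → c < n → Σ ℕ λ u → Σ ℕ λ v → u < c × c ≤ v × Inv u v
    Inv-across {c} 0<c c<n with anyUpTo? (λ u → anyUpTo? (λ v → c ≤? v ×-dec Inv? u v) n) c
    ... | yes (u , u<c , v , _ , c≤v , uv) = u , v , u<c , c≤v , uv
    ... | no ∄uv = ⊥-elim (¬uncrossed-cut 0<c c<n
                             (λ u<c c≤v uv → ∄uv (_ , u<c , _ , proj₁ (proj₂ uv) , c≤v , uv)))

    ¬Back₁-adjacent : ∀ {a} → ¬ Back₁ a (suc a)
    ¬Back₁-adjacent {a} a1 =
      ¬Back₁-closed ≤-refl (proj₁ (proj₂ a1)) (proper a) (Back₁-Closed-by-partners partner)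
      where
      proper : ∀ a → 0 < a ⊎ 2 + a < n
      proper zero    = inj₂ 3≤n
      proper (suc _) = inj₁ z<s
      partner : ∀ {x} → InInterval a (2 + a) x → ∃ λ y → Back₁ x y × InInterval a (2 + a) y
      partner x∈ with InInterval-suc x∈
      ... | inj₁ refl = a , Back₁-sym a1 , k+lo∈ a z<s
      ... | inj₂ x∈′ with InInterval-suc x∈′
      ...   | inj₁ refl        = 1 + a , a1 , k+lo∈ a (s<s z<s)
      ...   | inj₂ (a≤x , x<a) = ⊥-elim (<⇒≱ x<a a≤x)

    ¬Back₁-crossing-block : ∀ {a} → 0 < a ⊎ 4 + a < n →
                            Back₁ a (2 + a) → ¬ Back₁ (1 + a) (3 + a)
    ¬Back₁-crossing-block {a} proper a2 b3 = ¬Back₁-closed (s≤s (s≤s (m≤n+m a 2))) (proj₁ (proj₂ b3))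
                                               proper (Back₁-Closed-by-partners partner)
      where
      partner : ∀ {x} → InInterval a (4 + a) x → ∃ λ y → Back₁ x y × InInterval a (4 + a) y
      partner x∈ with InInterval-suc x∈
      ... | inj₁ refl = 1 + a , Back₁-sym b3 , k+lo∈ a (s<s z<s)
      ... | inj₂ x∈′ with InInterval-suc x∈′
      ...   | inj₁ refl = a , Back₁-sym a2 , k+lo∈ a z<s
      ...   | inj₂ x∈″ with InInterval-suc x∈″
      ...     | inj₁ refl = 3 + a , b3 , k+lo∈ a (s<s (s<s (s<s z<s)))
      ...     | inj₂ x∈‴ with InInterval-suc x∈‴
      ...       | inj₁ refl        = 2 + a , a2 , k+lo∈ a (s<s (s<s z<s))
      ...       | inj₂ (a≤x , x<a) = ⊥-elim (<⇒≱ x<a a≤x)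

    -- The block [0,4) is then everything, but {0,3} is homogeneous.
    ¬Back₁-crossing-n≡4 : n ≡ 4 → Back₁ 0 2 → ¬ Back₁ 1 3
    ¬Back₁-crossing-n≡4 n≡4 e02 e13 =
      no-homogeneous Ends (λ x → x ≟ 0 ⊎-dec x ≟ 3) (λ _ → <4⇒<n ∘ ends<4)
        (inj₁ refl) (inj₂ refl) (λ ())
        (<4⇒<n (s<s z<s)) (λ { (inj₁ ()) ; (inj₂ ()) }) homogeneous
      where
      Ends : ℕ → Set
      Ends x = x ≡ 0 ⊎ x ≡ 3
      ends<4 : ∀ {x} → Ends x → x < 4
      ends<4 (inj₁ refl) = z<s
      ends<4 (inj₂ refl) = ≤-refl
      <4⇒<n : ∀ {x} → x < 4 → x < n
      <4⇒<n x<4 = subst (_ <_) (sym n≡4) x<4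
      0-beats-1 : 0 beats 1
      0-beats-1 with beats-total (<4⇒<n z<s) (<4⇒<n (s<s z<s)) (λ ())
      ... | inj₁ 0→1 = 0→1
      ... | inj₂ 1→0 with back₁-unique e02 (<4⇒<n z<s , <4⇒<n (s<s z<s) , inj₁ (z<s , 1→0))
      ...   | ()
      2-beats-3 : 2 beats 3
      2-beats-3 with beats-total (<4⇒<n (s<s (s<s z<s))) (<4⇒<n ≤-refl) (λ ())
      ... | inj₁ 2→3 = 2→3
      ... | inj₂ 3→2
        with back₁-unique (Back₁-sym e02) (<4⇒<n (s<s (s<s z<s)) , <4⇒<n ≤-refl , inj₁ (≤-refl , 3→2))
      ...   | ()
      homogeneous : ∀ w → w < n → ¬ Ends w →
                    (∀ x → Ends x → w beats x) ⊎ (∀ x → Ends x → x beats w)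
      homogeneous 0 _ ¬end = ⊥-elim (¬end (inj₁ refl))
      homogeneous 1 _ _    =
        inj₂ λ { _ (inj₁ refl) → 0-beats-1 ; _ (inj₂ refl) → Back₁-beats (s<s z<s) e13 }
      homogeneous 2 _ _    =
        inj₁ λ { _ (inj₁ refl) → Back₁-beats z<s e02 ; _ (inj₂ refl) → 2-beats-3 }
      homogeneous 3 _ ¬end = ⊥-elim (¬end (inj₂ refl))
      homogeneous (suc (suc (suc (suc w)))) 4+w<n _ =
        ⊥-elim (<⇒≱ (subst (_ <_) n≡4 4+w<n) (m≤m+n 4 w))

    ¬Back₁-crossing : ∀ {a} → Back₁ a (2 + a) → ¬ Back₁ (1 + a) (3 + a)
    ¬Back₁-crossing {suc a} = ¬Back₁-crossing-block (inj₁ z<s)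
    ¬Back₁-crossing {zero} with 4 <? n
    ... | yes 4<n = ¬Back₁-crossing-block (inj₂ 4<n)
    ... | no  4≮n = λ e02 e13 →
      ¬Back₁-crossing-n≡4 (≤-antisym (≮⇒≥ 4≮n) (proj₁ (proj₂ e13))) e02 e13

    ¬Inv-square : ∀ {a} → Inv a (2 + a) → Inv a (3 + a) →
                  Inv (1 + a) (2 + a) → ¬ Inv (1 + a) (3 + a)
    ¬Inv-square {a} a2 a3 b2 b3 with Inverted-partners (inj₁ b2) (inj₁ b3) (<⇒≢ (n<1+n _))
    ... | inj₁ (b2₁ , _) = ¬Back₁-adjacent b2₁
    ... | inj₂ (_ , b3₁) with Inverted-partners (inj₁ a2) (inj₁ a3) (<⇒≢ (n<1+n _))
    ...   | inj₁ (a2₁ , _) = ¬Back₁-crossing a2₁ b3₁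
    ...   | inj₂ (_ , a3₁) = <⇒≢ (n<1+n a) (back₁-unique (Back₁-sym a3₁) (Back₁-sym b3₁))

    -- relabel swaps each inverted adjacent pair a, a+1; these pairs are disjoint by
    -- ¬Inv-chain.  (At a = 0 the condition ¬ Inv (pred a) a is vacuous.)
    data Relabelling : ℕ → ℕ → Set where
      up    : ∀ {a} → Inv a (suc a) → Relabelling a (suc a)
      down  : ∀ {a} → Inv a (suc a) → Relabelling (suc a) a
      fixed : ∀ {a} → ¬ Inv a (suc a) → ¬ Inv (pred a) a → Relabelling a a

    relabelling : ∀ a → ∃ (Relabelling a)
    relabelling a with Inv? a (suc a)
    ... | yes a↑ = suc a , up a↑
    relabelling zero    | no ¬a↑ = 0 , fixed ¬a↑ (λ (0<0 , _) → <-irrefl refl 0<0)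
    relabelling (suc a) | no ¬a↑ with Inv? a (suc a)
    ...   | yes a↓ = a , down a↓
    ...   | no ¬a↓ = suc a , fixed ¬a↑ ¬a↓

    relabel : ℕ → ℕ
    relabel a = proj₁ (relabelling a)

    relabel-view : ∀ a → Relabelling a (relabel a)
    relabel-view a = proj₂ (relabelling a)

    relabel-up : ∀ {a} → Inv a (suc a) → relabel a ≡ suc a
    relabel-up {a} a↑ with relabel a | relabel-view a
    ... | _ | up _          = refl
    ... | _ | down a′↑      = ⊥-elim (¬Inv-chain a′↑ a↑)
    ... | _ | fixed ¬a↑ _   = ⊥-elim (¬a↑ a↑)

    relabel-down : ∀ {a} → Inv a (suc a) → relabel (suc a) ≡ a
    relabel-down {a} a↑ with relabel (suc a) | relabel-view (suc a)
    ... | _ | up a1↑        = ⊥-elim (¬Inv-chain a↑ a1↑)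
    ... | _ | down _        = refl
    ... | _ | fixed _ ¬a↓   = ⊥-elim (¬a↓ a↑)

    relabel-fixed : ∀ {a} → ¬ Inv a (suc a) → ¬ Inv (pred a) a → relabel a ≡ a
    relabel-fixed {a} ¬a↑ ¬a↓ with relabel a | relabel-view a
    ... | _ | up a↑     = ⊥-elim (¬a↑ a↑)
    ... | _ | down a′↑  = ⊥-elim (¬a↓ a′↑)
    ... | _ | fixed _ _ = refl

    relabel-<n : ∀ {a} → a < n → relabel a < n
    relabel-<n {a} a<n with relabel a | relabel-view a
    ... | _ | up (_ , 1+a<n , _) = 1+a<n
    ... | _ | down _             = <-trans (n<1+n _) a<n
    ... | _ | fixed _ _          = a<n

    relabel-involutive : ∀ a → relabel (relabel a) ≡ a
    relabel-involutive a with relabel a | relabel-view a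
    ... | _ | up a↑     = relabel-down a↑
    ... | _ | down a↑   = relabel-up a↑
    ... | _ | fixed ¬a↑ ¬a↓ = relabel-fixed ¬a↑ ¬a↓

    relabel≤suc : ∀ a → relabel a ≤ suc a
    relabel≤suc a with relabel a | relabel-view a
    ... | _ | up _      = ≤-refl
    ... | _ | down _    = m≤n⇒m≤1+n (n≤1+n _)
    ... | _ | fixed _ _ = n≤1+n a

    ≤suc-relabel : ∀ a → a ≤ suc (relabel a)
    ≤suc-relabel a with relabel a | relabel-view a
    ... | _ | up _      = m≤n⇒m≤1+n (n≤1+n a)
    ... | _ | down _    = ≤-refl
    ... | _ | fixed _ _ = n≤1+n a

    Inv-adjacent⇒Back₂ : ∀ {a} → Inv a (suc a) → Back₂ a (suc a)
    Inv-adjacent⇒Back₂ a↑ with Inv⇒Back a↑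
    ... | inj₁ a↑₁ = ⊥-elim (¬Back₁-adjacent a↑₁)
    ... | inj₂ a↑₂ = a↑₂

    ¬Inv-past-unlinked : ∀ {u a w} → ¬ Inv (pred a) a → Inv u a → a < w → ¬ Inv u w
    ¬Inv-past-unlinked {a = suc a} ¬a↓ ua a<w uw with m≤n⇒m<n∨m≡n (s≤s⁻¹ (proj₁ ua))
    ... | inj₂ refl = ¬a↓ ua
    ... | inj₁ u<a with Inv-split u<a (n<1+n a) ua
    ...   | inj₂ a↓  = ¬a↓ a↓
    ...   | inj₁ u→a = Inverted-degree≤2 (inj₁ u→a) (inj₁ ua) (inj₁ uw)
                         (<⇒≢ (n<1+n a)) (<⇒≢ (<-trans (n<1+n a) a<w)) (<⇒≢ a<w)

    Inv-shift-to-unlinked : ∀ {u a v} → ¬ Inv (pred a) a → u ≤ a → a < v → Inv u v → Inv a v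
    Inv-shift-to-unlinked ¬a↓ u≤a a<v uv with m≤n⇒m<n∨m≡n u≤a
    ... | inj₂ refl = uv
    ... | inj₁ u<a with Inv-split u<a a<v uv
    ...   | inj₁ ua = ⊥-elim (¬Inv-past-unlinked ¬a↓ ua a<v uv)
    ...   | inj₂ av = av

    Inv-out-of-unlinked : ∀ {a} → ¬ Inv (pred a) a → 1 + a < n → Σ ℕ λ v → 1 + a ≤ v × Inv a v
    Inv-out-of-unlinked ¬a↓ 1+a<n with Inv-across z<s 1+a<n
    ... | _ , v , u<1+a , 1+a≤v , uv = v , 1+a≤v , Inv-shift-to-unlinked ¬a↓ (s≤s⁻¹ u<1+a) 1+a≤v uv

    Inv-out-of-up : ∀ {a} → Inv a (1 + a) → 2 + a < n → Σ ℕ λ v → 2 + a ≤ v × Inv a v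
    Inv-out-of-up {a} a↑ 2+a<n with Inv-across z<s 2+a<n
    ... | u , v , u<2+a , 2+a≤v , uv with m≤n⇒m<n∨m≡n (s≤s⁻¹ u<2+a)
    ...   | inj₂ refl = ⊥-elim (¬Inv-chain a↑ uv)
    ...   | inj₁ u<1+a = v , 2+a≤v ,
              Inv-shift-to-unlinked (λ a↓ → ¬Inv-chain a↓ a↑) (s≤s⁻¹ u<1+a) (<-trans (n<1+n a) 2+a≤v) uv

    Back₁-up-fixed : ∀ {a} → Inv a (1 + a) → ¬ Inv (2 + a) (3 + a) → 2 + a < n → Back₁ a (2 + a)
    Back₁-up-fixed {a} a↑ ¬c↑ 2+a<n with Inv-out-of-up a↑ 2+a<n
    ... | v , 2+a≤v , av =
      Inverted-partner-Back₁ (inj₁ (a→2+a v 2+a≤v av)) (Inv-adjacent⇒Back₂ a↑) (>⇒≢ (n<1+n _))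
      where
      a→2+a : ∀ v → 2 + a ≤ v → Inv a v → Inv a (2 + a)
      a→2+a v 2+a≤v av with Inv-reach av
      ... | inj₁ refl          = ⊥-elim (<⇒≱ (n<1+n _) 2+a≤v)
      ... | inj₂ (inj₁ refl)   = av
      ... | inj₂ (inj₂ refl) with Inv-split (m<n+m a z<s) (n<1+n _) av
      ...   | inj₁ a2 = a2
      ...   | inj₂ c↑ = ⊥-elim (¬c↑ c↑)

    Back₁-up-up : ∀ {a} → Inv a (1 + a) → Inv (2 + a) (3 + a) → Back₁ a (3 + a)
    Back₁-up-up {a} a↑ c↑ with Inv-out-of-up a↑ (Inv-<n c↑)
    ... | v , 2+a≤v , av with Inv-reach av
    ...   | inj₁ refl        = ⊥-elim (<⇒≱ (n<1+n _) 2+a≤v)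
    ...   | inj₂ (inj₁ refl) = ⊥-elim (¬Inv-chain av c↑)
    ...   | inj₂ (inj₂ refl) =
      Inverted-partner-Back₁ (inj₁ av) (Inv-adjacent⇒Back₂ a↑) (>⇒≢ (m<n+m (1 + a) {2} z<s))

    Back₁-fixed-up : ∀ {a} → ¬ Inv (pred a) a → Inv (1 + a) (2 + a) → Back₁ a (2 + a)
    Back₁-fixed-up {a} ¬a↓ b↑ with Inv-out-of-unlinked ¬a↓ (Inv-<n b↑)
    ... | _ , _ , av = Back₁-sym
      (Inverted-partner-Back₁ (inj₂ (a→2+a av)) (Back₂-sym (Inv-adjacent⇒Back₂ b↑)) (<⇒≢ (n<1+n a)))
      where
      a→2+a : ∀ {v} → Inv a v → Inv a (2 + a)
      a→2+a av with Inv-reach av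
      ... | inj₁ refl        = ⊥-elim (¬Inv-chain av b↑)
      ... | inj₂ (inj₁ refl) = av
      ... | inj₂ (inj₂ refl) with Inv-split (m<n+m a z<s) (n<1+n _) av
      ...   | inj₁ a2 = a2
      ...   | inj₂ c↑ = ⊥-elim (¬Inv-chain b↑ c↑)

    ¬fixed-fixed : ∀ {a} → ¬ Inv (pred a) a → ¬ Inv a (1 + a) → ¬ Inv (1 + a) (2 + a) →
                   ¬ 1 + a < n
    ¬fixed-fixed {a} ¬a↓ ¬a↑ ¬b↑ 1+a<n with Inv-out-of-unlinked ¬a↓ 1+a<n
    ... | v , _ , av with Inv-reach av
    ...   | inj₁ refl = ¬a↑ av
    ...   | inj₂ (inj₁ refl) = Sum.[ ¬a↑ , ¬b↑ ]′ (Inv-split (n<1+n a) (n<1+n _) av)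
    ...   | inj₂ (inj₂ refl) with Inv-split (n<1+n a) (m<n+m (1 + a) {2} z<s) av
    ...     | inj₁ a↑ = ¬a↑ a↑
    ...     | inj₂ b3 with Inv-split (n<1+n _) (n<1+n _) b3
    ...       | inj₁ b↑ = ¬b↑ b↑
    ...       | inj₂ c3 = Inverted-degree≤2 (inj₂ av) (inj₂ b3) (inj₂ c3)
                            (<⇒≢ (n<1+n a)) (<⇒≢ (m<n+m a z<s)) (<⇒≢ (n<1+n _))

    Back₁⇒relabel-suc : ∀ {a b} → a < b → Back₁ a b → relabel b ≡ suc (relabel a)
    Back₁⇒relabel-suc {a} a<b ab₁ with Back₁⇒Inverted ab₁
    ... | inj₂ (b<a , _) = ⊥-elim (<-asym a<b b<a)
    ... | inj₁ ab with Inv-reach ab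
    ...   | inj₁ refl = ⊥-elim (¬Back₁-adjacent ab₁)
    ...   | inj₂ (inj₁ refl) with Inv-split (n<1+n a) (n<1+n _) ab
    ...     | inj₁ a↑ =
      trans (relabel-fixed (¬Inv-chain ab) (¬Inv-chain a↑)) (cong suc (sym (relabel-up a↑)))
    ...     | inj₂ b↑ = trans (relabel-down b↑)
      (cong suc (sym (relabel-fixed (λ a↑ → ¬Inv-chain a↑ b↑) (λ a↓ → ¬Inv-chain a↓ ab))))
    Back₁⇒relabel-suc {a} a<b ab₁ | inj₁ ab | inj₂ (inj₂ refl)
      with Inv-split (n<1+n a) (m<n+m (1 + a) {2} z<s) ab | Inv-split (m<n+m a z<s) (n<1+n _) ab
    ... | inj₁ a↑ | inj₁ a2 = ⊥-elim (Inverted-degree≤2 (inj₁ a↑) (inj₁ a2) (inj₁ ab)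
                                        (<⇒≢ (n<1+n _)) (<⇒≢ (m<n+m (1 + a) {2} z<s)) (<⇒≢ (n<1+n _)))
    ... | inj₂ b3 | inj₂ c3 = ⊥-elim (Inverted-degree≤2 (inj₂ ab) (inj₂ b3) (inj₂ c3)
                                        (<⇒≢ (n<1+n a)) (<⇒≢ (m<n+m a z<s)) (<⇒≢ (n<1+n _)))
    ... | inj₁ a↑ | inj₂ c↑ = trans (relabel-down c↑) (cong suc (sym (relabel-up a↑)))
    ... | inj₂ b3 | inj₁ a2 with Inv-split (n<1+n a) (n<1+n _) a2
    ...   | inj₁ a↑ = ⊥-elim (Inverted-degree≤2 (inj₁ a↑) (inj₁ a2) (inj₁ ab)
                                (<⇒≢ (n<1+n _)) (<⇒≢ (m<n+m (1 + a) {2} z<s)) (<⇒≢ (n<1+n _)))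
    ...   | inj₂ b↑ = ⊥-elim (¬Inv-square a2 ab b↑ b3)

    relabel-suc⇒Back₁ : ∀ {a b} → a < b → b < n → relabel b ≡ suc (relabel a) → Back₁ a b
    relabel-suc⇒Back₁ {a} {b} a<b b<n eq with relabel a | relabel-view a | relabel b | relabel-view b | eq
    ... | _ | up a↑         | _ | up b↑         | refl = ⊥-elim (¬Inv-chain a↑ b↑)
    ... | _ | up a↑         | _ | down c↑       | refl = Back₁-up-up a↑ c↑
    ... | _ | up a↑         | _ | fixed ¬c↑ _   | refl = Back₁-up-fixed a↑ ¬c↑ b<n
    ... | _ | down _        | _ | up _          | refl = ⊥-elim (<⇒≱ a<b (n≤1+n _))
    ... | _ | down a′↑      | _ | down a↑       | refl = ⊥-elim (¬Inv-chain a′↑ a↑)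
    ... | _ | down _        | _ | fixed _ _     | refl = ⊥-elim (<-irrefl refl a<b)
    ... | _ | fixed _ _     | _ | up _          | refl = ⊥-elim (<-irrefl refl a<b)
    ... | _ | fixed _ ¬a↓   | _ | down b↑       | refl = Back₁-fixed-up ¬a↓ b↑
    ... | _ | fixed ¬a↑ ¬a↓ | _ | fixed ¬b↑ _   | refl = ⊥-elim (¬fixed-fixed ¬a↓ ¬a↑ ¬b↑ b<n)

    relabel-injective : ∀ {a b} → relabel a ≡ relabel b → a ≡ b
    relabel-injective {a} {b} eq =
      trans (sym (relabel-involutive a)) (trans (cong relabel eq) (relabel-involutive b))

    beats⇒PEdgeℕ : ∀ {a b} → a < n → b < n → a beats b → PEdgeℕ (relabel a) (relabel b)
    beats⇒PEdgeℕ {a} {b} a<n b<n a→b with <-cmp a b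
    ... | tri≈ _ refl _ = ⊥-elim (beats-asym a→b a→b)
    ... | tri> _ _ b<a = inj₂ (Back₁⇒relabel-suc b<a (b<n , a<n , inj₁ (b<a , a→b)))
    ... | tri< a<b _ _ with <-cmp (relabel a) (relabel b)
    ...   | tri≈ _ ra≡rb _ = ⊥-elim (<⇒≢ a<b (relabel-injective ra≡rb))
    ...   | tri> _ _ rb<ra =
      inj₂ (≤-antisym (≤-trans (relabel≤suc a) (≤-trans a<b (≤suc-relabel b))) rb<ra)
    ...   | tri< ra<rb _ _ with m≤n⇒m<n∨m≡n ra<rb
    ...     | inj₁ 1+ra<rb = inj₁ 1+ra<rb
    ...     | inj₂ 1+ra≡rb =
      ⊥-elim (beats-asym a→b (Back₁-beats a<b (relabel-suc⇒Back₁ a<b b<n (sym 1+ra≡rb))))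

    PEdgeℕ⇒beats : ∀ {a b} → a < n → b < n → PEdgeℕ (relabel a) (relabel b) → a beats b
    PEdgeℕ⇒beats {a} {b} a<n b<n e with <-cmp a b
    ... | tri≈ _ refl _ = ⊥-elim (PEdgeℕ-irrefl e)
    ... | tri< a<b _ _ with beats-total a<n b<n (<⇒≢ a<b)
    ...   | inj₁ a→b = a→b
    ...   | inj₂ b→a =
      ⊥-elim (PEdgeℕ-¬suc (subst (PEdgeℕ _) (Back₁⇒relabel-suc a<b (a<n , b<n , inj₁ (a<b , b→a))) e))
    PEdgeℕ⇒beats {a} {b} a<n b<n (inj₁ 2+ra≤rb) | tri> _ _ b<a =
      ⊥-elim (<⇒≱ 2+ra≤rb (≤-trans (relabel≤suc b) (≤-trans b<a (≤suc-relabel a))))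
    PEdgeℕ⇒beats {a} {b} a<n b<n (inj₂ ra≡1+rb) | tri> _ _ b<a =
      Back₁-beats b<a (relabel-suc⇒Back₁ b<a a<n ra≡1+rb)

    beats⇔PEdgeℕ : ∀ {a b} → a < n → b < n → a beats b ⇔ PEdgeℕ (relabel a) (relabel b)
    beats⇔PEdgeℕ a<n b<n = mk⇔ (beats⇒PEdgeℕ a<n b<n) (PEdgeℕ⇒beats a<n b<n)

PEdge⇔PEdgeℕ : ∀ {n} {i j : Fin n} {x y} → toℕ i ≡ x → toℕ j ≡ y → PEdge i j ⇔ PEdgeℕ x y
PEdge⇔PEdgeℕ {x = x} {y} refl refl =
  mk⇔ (Sum.map (subst (_≤ y) (+-comm x 2)) (λ x≡y+1 → trans x≡y+1 (+-comm y 1)))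
      (Sum.map (subst (_≤ y) (+-comm 2 x)) (λ x≡1+y → trans x≡1+y (+-comm 1 y)))

⇔-yes : ∀ {A B : Set} → A → B → A ⇔ B
⇔-yes a b = mk⇔ (λ _ → b) (λ _ → a)

⇔-no : ∀ {A B : Set} → ¬ A → ¬ B → A ⇔ B
⇔-no ¬a ¬b = mk⇔ (⊥-elim ∘ ¬a) (⊥-elim ∘ ¬b)

IsoToP-≤2 : ∀ {n} (G : Tournament n) → n ≤ 2 → IsoToP G
IsoToP-≤2 {0} G _ = Permutation.id , λ ()
IsoToP-≤2 {1} G _ =
  Permutation.id , λ { fzero fzero → ⇔-no (irrefl G fzero) λ { (inj₁ ()) ; (inj₂ ()) } }
IsoToP-≤2 {2} G _ with total G fzero (fsuc fzero) (λ ())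
... | inj₂ 1→0 = Permutation.id , edges
  where
  edges : ∀ u v → _⇒_ G u v ⇔ PEdge u v
  edges fzero        fzero        = ⇔-no (irrefl G _) λ { (inj₁ ()) ; (inj₂ ()) }
  edges fzero        (fsuc fzero) = ⇔-no (asym G _ _ 1→0) λ { (inj₁ (s≤s ())) ; (inj₂ ()) }
  edges (fsuc fzero) fzero        = ⇔-yes 1→0 (inj₂ refl)
  edges (fsuc fzero) (fsuc fzero) = ⇔-no (irrefl G _) λ { (inj₁ (s≤s ())) ; (inj₂ ()) }
... | inj₁ 0→1 = Permutation.transpose fzero (fsuc fzero) , edges
  where
  edges : ∀ u v → _⇒_ G u v ⇔ PEdge (Permutation.transpose fzero (fsuc fzero) ⟨$⟩ʳ u)
                                     (Permutation.transpose fzero (fsuc fzero) ⟨$⟩ʳ v)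
  edges fzero        fzero        = ⇔-no (irrefl G _) λ { (inj₁ (s≤s ())) ; (inj₂ ()) }
  edges fzero        (fsuc fzero) = ⇔-yes 0→1 (inj₂ refl)
  edges (fsuc fzero) fzero        = ⇔-no (asym G _ _ 0→1) λ { (inj₁ (s≤s ())) ; (inj₂ ()) }
  edges (fsuc fzero) (fsuc fzero) = ⇔-no (irrefl G _) λ { (inj₁ ()) ; (inj₂ ()) }
IsoToP-≤2 {suc (suc (suc _))} G (s≤s (s≤s ()))

module Positions {n : ℕ} (G : Tournament n) (σ τ : Ordering n)
                 (σ-matching : Matching G σ) (τ-matching : Matching G τ) where

  vertex : ∀ {a} → .(a < n) → Fin n
  vertex a<n = σ ⟨$⟩ʳ fromℕ< a<n

  position : Fin n → ℕ
  position v = toℕ (σ ⟨$⟩ˡ v)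

  position-vertex : ∀ {a} (a<n : a < n) → position (vertex a<n) ≡ a
  position-vertex a<n = trans (cong toℕ (inverseˡ σ)) (toℕ-fromℕ< a<n)

  vertex-position : ∀ v → vertex (toℕ<n (σ ⟨$⟩ˡ v)) ≡ v
  vertex-position v = trans (cong (σ ⟨$⟩ʳ_) (fromℕ<-toℕ _ (toℕ<n _))) (inverseʳ σ)

  vertex-injective : ∀ {a b} (a<n : a < n) (b<n : b < n) → vertex a<n ≡ vertex b<n → a ≡ b
  vertex-injective a<n b<n eq =
    trans (sym (position-vertex a<n)) (trans (cong position eq) (position-vertex b<n))

  _beats_ : ℕ → ℕ → Set
  a beats b = Σ (a < n) λ a<n → Σ (b < n) λ b<n → _⇒_ G (vertex a<n) (vertex b<n)

  edge⇔beats : ∀ u v → _⇒_ G u v ⇔ position u beats position v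
  edge⇔beats u v = mk⇔
    (λ u→v → toℕ<n _ , toℕ<n _ ,
             subst₂ (_⇒_ G) (sym (vertex-position u)) (sym (vertex-position v)) u→v)
    (λ (_ , _ , u→v) → subst₂ (_⇒_ G) (vertex-position u) (vertex-position v) u→v)

  beats-total : ∀ {a b} → a < n → b < n → a ≢ b → a beats b ⊎ b beats a
  beats-total a<n b<n a≢b with total G (vertex a<n) (vertex b<n) (a≢b ∘ vertex-injective a<n b<n)
  ... | inj₁ a→b = inj₁ (a<n , b<n , a→b)
  ... | inj₂ b→a = inj₂ (b<n , a<n , b→a)

  beats-asym : ∀ {a b} → a beats b → ¬ b beats a
  beats-asym (_ , _ , a→b) (_ , _ , b→a) = asym G _ _ a→b b→a

  -- Junk value a for a ≥ n.
  q : ℕ → ℕ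
  q a with a <? n
  ... | yes a<n = toℕ (τ ⟨$⟩ˡ vertex a<n)
  ... | no  _   = a

  q-vertex : ∀ {a} (a<n : a < n) → q a ≡ toℕ (τ ⟨$⟩ˡ vertex a<n)
  q-vertex {a} a<n with a <? n
  ... | yes _  = refl
  ... | no a≮n = ⊥-elim (a≮n a<n)

  q-injective : ∀ {a b} → a < n → b < n → q a ≡ q b → a ≡ b
  q-injective a<n b<n qa≡qb = vertex-injective a<n b<n (Injection.injective (↔⇒↣ (Permutation.flip τ))
    (toℕ-injective (trans (sym (q-vertex a<n)) (trans qa≡qb (q-vertex b<n)))))

  q-<n : ∀ {a} → a < n → q a < n
  q-<n a<n = subst (_< n) (sym (q-vertex a<n)) (toℕ<n _)

  Back-unique : (ρ : Ordering n) → Matching G ρ → (r : ℕ → ℕ) →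
    (∀ {a} (a<n : a < n) → r a ≡ toℕ (ρ ⟨$⟩ˡ vertex a<n)) →
    ∀ {x y z} → Back n _beats_ r x y → Back n _beats_ r x z → y ≡ z
  Back-unique ρ matching r r-spec xy@(x<n , y<n , _) xz@(_ , z<n , _) =
    vertex-injective y<n z<n (Injection.injective (↔⇒↣ (Permutation.flip ρ))
      (Matching⇒partner-unique {G = G} {ρ = ρ} matching (partner xy) (partner xz)))
    where
    at : ∀ {a} → .(a < n) → Fin n
    at a<n = ρ ⟨$⟩ˡ vertex a<n
    backedge : ∀ {a b} (a<n : a < n) (b<n : b < n) → r a < r b → b beats a →
               Backedge G ρ (at a<n) (at b<n)
    backedge a<n b<n ra<rb (_ , _ , b→a) =
      subst₂ _<_ (r-spec a<n) (r-spec b<n) ra<rb ,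
      subst₂ (_⇒_ G) (sym (inverseʳ ρ)) (sym (inverseʳ ρ)) b→a
    partner : ∀ {a b} (ab : Back n _beats_ r a b) →
              BackPartner G ρ (at (proj₁ ab)) (at (proj₁ (proj₂ ab)))
    partner (a<n , b<n , inj₁ (ra<rb , b→a)) = inj₁ (backedge a<n b<n ra<rb b→a)
    partner (a<n , b<n , inj₂ (rb<ra , a→b)) = inj₂ (backedge b<n a<n rb<ra a→b)

  open TwoMatchingOrders n _beats_ q beats-total beats-asym q-injective
         (Back-unique σ σ-matching (λ a → a) (λ a<n → sym (position-vertex a<n)))
         (Back-unique τ τ-matching q q-vertex)

  Prime⇒NoHomogeneousSet : Prime G → NoHomogeneousSet n _beats_
  Prime⇒NoHomogeneousSet prime P P? P⇒<n {x} {y} {w} Px Py x≢y w<n ¬Pw homogeneous =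
    prime X X-homogeneous (1<∣X∣ , ∣X∣<n)
    where
    X : Subset n
    X = tabulate (λ v → isYes (P? (position v)))
    ∈X⇒P : ∀ {v} → v ∈ X → P (position v)
    ∈X⇒P {v} v∈X =
      toWitness (Equivalence.from T-≡ (trans (sym (lookup∘tabulate _ v)) ([]=⇒lookup v∈X)))
    P⇒∈X : ∀ {v} → P (position v) → v ∈ X
    P⇒∈X {v} Pv = lookup⇒[]= v X (trans (lookup∘tabulate _ v) (Equivalence.to T-≡ (fromWitness Pv)))
    vertex∈X : ∀ {a} (Pa : P a) → vertex (P⇒<n a Pa) ∈ X
    vertex∈X {a} Pa = P⇒∈X (subst P (sym (position-vertex (P⇒<n a Pa))) Pa)
    1<∣X∣ : 1 < ∣ X ∣
    1<∣X∣ = subst (_< ∣ X ∣) (∣⁅x⁆∣≡1 (vertex (P⇒<n x Px)))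
      (p⊂q⇒∣p∣<∣q∣ ((λ z∈⁅x⁆ → subst (_∈ X) (sym (x∈⁅y⁆⇒x≡y _ z∈⁅x⁆)) (vertex∈X Px)) ,
                    vertex (P⇒<n y Py) , vertex∈X Py ,
                    x≢y ∘ sym ∘ vertex-injective (P⇒<n y Py) (P⇒<n x Px) ∘ x∈⁅y⁆⇒x≡y _))
    ∣X∣<n : ∣ X ∣ < n
    ∣X∣<n = subst (∣ X ∣ <_) (∣⊤∣≡n n)
      (p⊂q⇒∣p∣<∣q∣ ((λ _ → ∈⊤) , vertex w<n , ∈⊤ ,
                    λ w∈X → ¬Pw (subst P (position-vertex w<n) (∈X⇒P w∈X))))
    X-homogeneous : Homogeneous G X
    X-homogeneous v v∉X with homogeneous (position v) (toℕ<n _) (v∉X ∘ P⇒∈X)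
    ... | inj₁ v-beats = inj₁ λ u u∈X → Equivalence.from (edge⇔beats v u) (v-beats _ (∈X⇒P u∈X))
    ... | inj₂ v-beaten = inj₂ λ u u∈X → Equivalence.from (edge⇔beats u v) (v-beaten _ (∈X⇒P u∈X))

  relabelling⇒IsoToP : (s : ℕ → ℕ) → (∀ {a} → a < n → s a < n) → (∀ a → s (s a) ≡ a) →
    (∀ {a b} → a < n → b < n → a beats b ⇔ PEdgeℕ (s a) (s b)) → IsoToP G
  relabelling⇒IsoToP s s-<n s-involutive beats⇔ = π , edge⇔PEdge
    where
    f : Fin n → Fin n
    f v = fromℕ< (s-<n (toℕ<n (σ ⟨$⟩ˡ v)))
    g : Fin n → Fin n
    g i = vertex (s-<n (toℕ<n i))
    toℕ-f : ∀ v → toℕ (f v) ≡ s (position v)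
    toℕ-f v = toℕ-fromℕ< _
    f∘g : ∀ i → f (g i) ≡ i
    f∘g i = toℕ-injective (trans (toℕ-f (g i))
              (trans (cong s (position-vertex (s-<n (toℕ<n i)))) (s-involutive (toℕ i))))
    g∘f : ∀ v → g (f v) ≡ v
    g∘f v = trans (cong (σ ⟨$⟩ʳ_) (toℕ-injective (trans (toℕ-fromℕ< _)
              (trans (cong s (toℕ-f v)) (s-involutive (position v)))))) (inverseʳ σ)
    π : Permutation′ n
    π = permutation f g f∘g g∘f
    edge⇔PEdge : ∀ u v → _⇒_ G u v ⇔ PEdge (π ⟨$⟩ʳ u) (π ⟨$⟩ʳ v)
    edge⇔PEdge u v =
      ⇔-sym (PEdge⇔PEdgeℕ (toℕ-f u) (toℕ-f v)) ⇔-∘ (beats⇔ (toℕ<n _) (toℕ<n _) ⇔-∘ edge⇔beats u v)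

  σ≗τ : (∀ {a b} → ¬ Inv a b) → ∀ i → σ ⟨$⟩ʳ i ≡ τ ⟨$⟩ʳ i
  σ≗τ no-inversion i = begin
    σ ⟨$⟩ʳ i                   ≡⟨ inverseʳ τ ⟨
    τ ⟨$⟩ʳ (τ ⟨$⟩ˡ (σ ⟨$⟩ʳ i)) ≡⟨ cong (τ ⟨$⟩ʳ_) (toℕ-injective τ⁻¹σi≡i) ⟩
    τ ⟨$⟩ʳ i                   ∎
    where
    q-increasing : ∀ {a b} → a < b → b < n → q a < q b
    q-increasing {a} {b} a<b b<n with <-cmp (q a) (q b)
    ... | tri< qa<qb _ _ = qa<qb
    ... | tri≈ _ qa≡qb _ = ⊥-elim (<⇒≢ a<b (q-injective (<-trans a<b b<n) b<n qa≡qb))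
    ... | tri> _ _ qb<qa = ⊥-elim (no-inversion (a<b , b<n , qb<qa))
    τ⁻¹σi≡i : toℕ (τ ⟨$⟩ˡ (σ ⟨$⟩ʳ i)) ≡ toℕ i
    τ⁻¹σi≡i = begin
      toℕ (τ ⟨$⟩ˡ (σ ⟨$⟩ʳ i))        ≡⟨ cong (λ j → toℕ (τ ⟨$⟩ˡ (σ ⟨$⟩ʳ j))) (fromℕ<-toℕ i (toℕ<n i)) ⟨
      toℕ (τ ⟨$⟩ˡ vertex (toℕ<n i)) ≡⟨ q-vertex (toℕ<n i) ⟨
      q (toℕ i)                     ≡⟨ f[m]≡m q q-increasing q-<n (toℕ<n i) ⟩
      toℕ i                         ∎

  Inv⇒IsoToP : Prime G → ∀ {a b} → Inv a b → IsoToP G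
  Inv⇒IsoToP prime ab with 3 ≤? n
  ... | no  3≰n = IsoToP-≤2 G (s≤s⁻¹ (≰⇒> 3≰n))
  ... | yes 3≤n = relabelling⇒IsoToP relabel relabel-<n relabel-involutive beats⇔PEdgeℕ
    where open WithInversion 3≤n (Prime⇒NoHomogeneousSet prime) ab

  σ≗τ-or-IsoToP : Prime G → (∀ i → σ ⟨$⟩ʳ i ≡ τ ⟨$⟩ʳ i) ⊎ IsoToP G
  σ≗τ-or-IsoToP prime with anyUpTo? (λ a → anyUpTo? (Inv? a) n) n
  ... | yes (_ , _ , _ , _ , ab) = inj₂ (Inv⇒IsoToP prime ab)
  ... | no  ∄ab = inj₁ (σ≗τ (λ ab → ∄ab (_ , Inv-<n ab , _ , proj₁ (proj₂ ab) , ab)))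

corollary5p5 : ∀ (n : ℕ) (G : Tournament n) → Prime G → ¬ IsoToP G →
    ∀ (σ τ : Ordering n) → Matching G σ → Matching G τ →
    ∀ (i : Fin n) → σ ⟨$⟩ʳ i ≡ τ ⟨$⟩ʳ i
corollary5p5 n G prime ¬IsoToP σ τ σ-matching τ-matching i =
  Sum.[ (λ σ≗τ → σ≗τ i) , ⊥-elim ∘ ¬IsoToP ]′
    (Positions.σ≗τ-or-IsoToP G σ τ σ-matching τ-matching prime)
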